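{- Let $T$ be a finite tree and $F$ a subgraph of $T$ with $V(F)=V(T)$ such that all connected components of $F$ have the same number of vertices. Then $F$ is the only subgraph of $T$ isomorphic to $F$, i.e., $|\mathrm{Sub}_F(T)|=1$.
   Context: For undirected graphs $F$ and $H$, $\mathrm{Sub}_F(H)=\{F'\subseteq H: F'\cong F\}$, where $F'\subseteq H$ means $V(F')\subseteq V(H)$ and $E(F')\subseteq E(H)$. -}

module Defs where

open import Data.Nat using (ℕ; zero; suc)
open import Data.Fin using (Fin; zero; suc; inject₁; fromℕ)
open import Data.Bool using (Bool; true; false)
open import Data.Product using (Σ; _×_; _,_; proj₁; proj₂; ∃)
open import Data.Empty using (⊥)
open import Relation.Binary.PropositionalEquality using (_≡_)
open import Relation.Nullary using (¬_)
open import Function.Bundles using (_↔_; Inverse)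
open import Function.Definitions using (Injective)

record Graph (n : ℕ) : Set where
  field
    adj    : Fin n → Fin n → Bool
    sym    : ∀ u v → adj u v ≡ adj v u
    irrefl : ∀ v → adj v v ≡ false
open Graph public

data Walk {n : ℕ} (a : Fin n → Fin n → Bool) : Fin n → Fin n → Set where
  [] : ∀ {v} → Walk a v v
  _∷_ : ∀ {u v w} → a u v ≡ true → Walk a v w → Walk a u w

Connected : ∀ {n} → Graph n → Set
Connected G = ∀ u v → Walk (adj G) u v

-- A cycle of length k = m + 3 : distinct vertices c 0, …, c (k-1), with
-- consecutive ones adjacent and c (k-1) adjacent to c 0.
record Cycle {n : ℕ} (G : Graph n) : Set where
  field
    m    : ℕ
    c    : Fin (suc (suc (suc m))) → Fin n
    inj  : Injective _≡_ _≡_ c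
    step : ∀ (i : Fin (suc (suc m))) → adj G (c (inject₁ i)) (c (suc i)) ≡ true
    close : adj G (c (fromℕ (suc (suc m)))) (c zero) ≡ true

Acyclic : ∀ {n} → Graph n → Set
Acyclic G = ¬ Cycle G

IsTree : ∀ {n} → Graph n → Set
IsTree G = Connected G × Acyclic G

record Subgraph {n : ℕ} (H : Graph n) : Set where
  field
    inV    : Fin n → Bool
    sadj   : Fin n → Fin n → Bool
    ssym   : ∀ u v → sadj u v ≡ sadj v u
    sub    : ∀ u v → sadj u v ≡ true → adj H u v ≡ true
    endsIn : ∀ u v → sadj u v ≡ true → inV u ≡ true
open Subgraph public

V : ∀ {n} {H : Graph n} → Subgraph H → Set
V {n} A = Σ (Fin n) (λ v → inV A v ≡ true)

_≅_ : ∀ {n} {H : Graph n} → Subgraph H → Subgraph H → Set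
A ≅ B = Σ (V A ↔ V B) λ f →
  ∀ (x y : V A) → sadj A (proj₁ x) (proj₁ y) ≡ sadj B (proj₁ (Inverse.to f x)) (proj₁ (Inverse.to f y))

_≈S_ : ∀ {n} {H : Graph n} → Subgraph H → Subgraph H → Set
_≈S_ {n} A B = (∀ v → inV A v ≡ inV B v) × (∀ u v → sadj A u v ≡ sadj B u v)

Spanning : ∀ {n} {H : Graph n} → Subgraph H → Set
Spanning {n} A = ∀ (v : Fin n) → inV A v ≡ true

SameComp : ∀ {n} {H : Graph n} → Subgraph H → Fin n → Fin n → Set
SameComp A v u = inV A v ≡ true × inV A u ≡ true × Walk (sadj A) v u

AllComponentsOfSize : ∀ {n} {H : Graph n} → Subgraph H → ℕ → Set
AllComponentsOfSize {n} A k =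
  ∀ (v : Fin n) → inV A v ≡ true →
    Σ (Fin n → Bool) λ S →
      (∀ u → (S u ≡ true → SameComp A v u) × (SameComp A v u → S u ≡ true))
      × (Fin k ↔ Σ (Fin n) (λ u → S u ≡ true))

UniqueCopy : ∀ {n} {H : Graph n} → Subgraph H → Set
UniqueCopy {H = H} F = (F ≅ F) × (∀ (F' : Subgraph H) → F' ≅ F → F' ≈S F)

module Submission where

-- Let F' ⊆ T be isomorphic to F.  Counting vertices shows that F'
-- is spanning too, and the isomorphism, being a permutation of V(T), shows
-- that the components of F' also all have k vertices.  So it suffices to
-- prove: if G and H are two such "balanced splits" of T, every edge uv of G
-- is an edge of H.  Suppose not.  Deleting uv from the acyclic graph T cuts
-- it; let A be the side of u (computed by breadth-first search; v ∉ A since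
-- a shortest u–v path avoiding uv would close a cycle with uv).  The only
-- T-edge leaving A is uv, which is not in H, so A is a union of
-- H-components and k divides |A|.  Let C be the G-component of u (so v ∈ C).
-- A ∖ C is a union of G-components, so k divides |A ∖ C| and hence |A ∩ C|;
-- but 0 < |A ∩ C| < |C| = k because u ∈ A ∩ C and v ∈ C ∖ A.

open import Defs hiding (sym)
open import Data.Nat using (ℕ; zero; suc; _+_; _∸_; _≤_; _<_; z≤n; s≤s; >-nonZero)
open import Data.Nat.Properties using (≤-refl; ≤-reflexive; ≤-trans; m≤n+m; <⇒≱; m<m+n; +-mono-≤; +-monoˡ-≤; +-comm; ≤-pred; m≤n⇒m<n∨m≡n; <-cmp; ∸-cancelˡ-≡; +-commutativeSemigroup)
open import Data.Nat.Divisibility using (_∣_; ∣-refl; _∣0; ∣m∣n⇒∣m+n; ∣m+n∣m⇒∣n; ∣⇒≤)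
open import Data.Fin using (Fin; zero; suc; inject₁; fromℕ; toℕ; _≟_)
open import Data.Fin.Properties using (+↔⊎; toℕ≤pred[n]; toℕ-injective; any?)
open import Data.Fin.Permutation using (↔⇒≡)
open import Data.Bool using (Bool; true; false; _∧_; _∨_; not)
import Data.Bool as Bool
open import Data.Bool.Properties using (∧-conicalˡ; ∧-conicalʳ; ∧-zeroʳ; ∨-zeroʳ; ¬-not; not-¬; not-injective)
open import Data.Product using (Σ; ∃; _×_; _,_; proj₁; proj₂)
open import Data.Product.Properties using (Σ-≡,≡→≡)
open import Data.Sum using (_⊎_; inj₁; inj₂)
open import Data.Sum.Function.Propositional using (_⊎-↔_)
open import Data.Empty using (⊥; ⊥-elim)
open import Function using (flip)
open import Function.Bundles using (_↔_; Inverse; mk↔ₛ′)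
open import Function.Definitions using (Injective)
open import Function.Properties.Inverse using (↔-trans; ↔-sym; ↔-refl)
open import Relation.Binary.PropositionalEquality
open import Relation.Binary.Definitions using (tri<; tri≈; tri>)
open import Relation.Nullary using (Dec; yes; no; does; ¬_; _×-dec_; _⊎-dec_)
open import Relation.Nullary.Decidable using (dec-true; dec-false)
open import Axiom.UniquenessOfIdentityProofs using (module Decidable⇒UIP)
open import Algebra.Properties.CommutativeSemigroup +-commutativeSemigroup using (interchange)

witness : ∀ {A : Set} (a? : Dec A) → does a? ≡ true → A
witness (yes a) _ = a
witness (no _) ()

bool-≡ : ∀ {a b : Bool} → (a ≡ true → b ≡ true) → (b ≡ true → a ≡ true) → a ≡ b
bool-≡ {true}  a⇒b _   = sym (a⇒b refl)
bool-≡ {false} {false} _ _ = refl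
bool-≡ {false} {true}  _ b⇒a = b⇒a refl

Vertices : ℕ → Set
Vertices n = Fin n → Bool

-- Membership facts, stated for the Booleans A x, B x so that they are
-- inferred from the membership proofs at hand.
module _ {a : Bool} where

  ∉⇒¬∈ : a ≡ false → ¬ a ≡ true
  ∉⇒¬∈ = not-¬

  ¬∈⇒∉ : ¬ a ≡ true → a ≡ false
  ¬∈⇒∉ = ¬-not

  ¬∉⇒∈ : ¬ a ≡ false → a ≡ true
  ¬∉⇒∈ = ¬-not

module _ {a b : Bool} where

  ∩-intro : a ≡ true → b ≡ true → a ∧ b ≡ true
  ∩-intro refl refl = refl

  ∩-elimˡ : a ∧ b ≡ true → a ≡ true
  ∩-elimˡ = ∧-conicalˡ a b

  ∩-elimʳ : a ∧ b ≡ true → b ≡ true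
  ∩-elimʳ = ∧-conicalʳ a b

  ∖-intro : a ≡ true → b ≡ false → a ∧ not b ≡ true
  ∖-intro refl refl = refl

  ∖-elimˡ : a ∧ not b ≡ true → a ≡ true
  ∖-elimˡ = ∧-conicalˡ a (not b)

  ∖-elimʳ : a ∧ not b ≡ true → b ≡ false
  ∖-elimʳ p = not-injective (∧-conicalʳ a (not b) p)

  ∨-introʳ : b ≡ true → a ∨ b ≡ true
  ∨-introʳ refl = ∨-zeroʳ a

  ∨-resolve : a ∨ b ≡ true → a ≡ false → b ≡ true
  ∨-resolve p refl = p

module _ {n : ℕ} where

  infix 4 _∈_ _∉_ _⊆_
  infixl 6 _∩_ _∖_

  _∈_ : Fin n → Vertices n → Set
  x ∈ A = A x ≡ true

  _∉_ : Fin n → Vertices n → Set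
  x ∉ A = A x ≡ false

  _⊆_ : Vertices n → Vertices n → Set
  A ⊆ B = ∀ x → x ∈ A → x ∈ B

  _∩_ : Vertices n → Vertices n → Vertices n
  (A ∩ B) x = A x ∧ B x

  _∖_ : Vertices n → Vertices n → Vertices n
  (A ∖ B) x = A x ∧ not (B x)

  -- The members of A, as a type (this is V(F) of Defs for A = inV F).
  Members : Vertices n → Set
  Members A = Σ (Fin n) (_∈ A)

  -- Membership proofs are unique, so members are determined by their vertex.
  member-≡ : ∀ {A : Vertices n} {x y : Fin n} {p : x ∈ A} {q : y ∈ A} →
             x ≡ y → _≡_ {A = Members A} (x , p) (y , q)
  member-≡ refl = Σ-≡,≡→≡ (refl , Decidable⇒UIP.≡-irrelevant Bool._≟_ _ _)

  nonempty : Vertices n → Bool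
  nonempty A = does (any? λ x → A x Bool.≟ true)

  nonempty-intro : (A : Vertices n) {x : Fin n} → x ∈ A → nonempty A ≡ true
  nonempty-intro A {x} xA = dec-true (any? _) (x , xA)

  nonempty-elim : (A : Vertices n) → nonempty A ≡ true → ∃ (_∈ A)
  nonempty-elim A = witness (any? _)

  inhabited? : (A : Vertices n) → (∃ λ x → x ∈ A) ⊎ (∀ x → x ∉ A)
  inhabited? A with any? (λ x → A x Bool.≟ true)
  ... | yes some = inj₁ some
  ... | no none  = inj₂ (λ x → ¬∈⇒∉ (λ xA → none (x , xA)))

bit : Bool → ℕ
bit true  = 1
bit false = 0

count : ∀ {n} → Vertices n → ℕ
count {zero}  A = 0
count {suc n} A = bit (A zero) + count (λ x → A (suc x))

members↔ : ∀ {n} (A : Vertices n) → Members A ↔ Fin (count A)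
members↔ {zero}  A = mk↔ₛ′ (λ { (() , _) }) (λ ()) (λ ()) (λ { (() , _) })
members↔ {suc n} A =
  ↔-trans first-or-rest (↔-trans (bit↔ (A zero) ⊎-↔ members↔ (λ x → A (suc x))) (↔-sym +↔⊎))
  where
  bit↔ : (b : Bool) → (b ≡ true) ↔ Fin (bit b)
  bit↔ true  = mk↔ₛ′ (λ _ → zero) (λ _ → refl) (λ { zero → refl }) (λ { refl → refl })
  bit↔ false = mk↔ₛ′ (λ ()) (λ ()) (λ ()) (λ ())
  first-or-rest : Members A ↔ (zero ∈ A ⊎ Members (λ x → A (suc x)))
  first-or-rest = mk↔ₛ′ (λ { (zero , p) → inj₁ p ; (suc x , p) → inj₂ (x , p) })
                        (λ { (inj₁ p) → zero , p ; (inj₂ (x , p)) → suc x , p })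
                        (λ { (inj₁ p) → refl ; (inj₂ (x , p)) → refl })
                        (λ { (zero , p) → refl ; (suc x , p) → refl })

count-↔ : ∀ {n} {A B : Vertices n} → Members A ↔ Members B → count A ≡ count B
count-↔ {A = A} {B} f = ↔⇒≡ (↔-trans (↔-sym (members↔ A)) (↔-trans f (members↔ B)))

count-ext : ∀ {n} {A B : Vertices n} → (∀ x → A x ≡ B x) → count A ≡ count B
count-ext {zero}  eq = refl
count-ext {suc n} eq = cong₂ _+_ (cong bit (eq zero)) (count-ext (λ x → eq (suc x)))

count-≤ : ∀ {n} (A : Vertices n) → count A ≤ n
count-≤ {zero}  A = z≤n
count-≤ {suc n} A = +-mono-≤ (bit≤1 (A zero)) (count-≤ (λ x → A (suc x)))
  where
  bit≤1 : ∀ b → bit b ≤ 1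
  bit≤1 true  = s≤s z≤n
  bit≤1 false = z≤n

count-pos : ∀ {n} (A : Vertices n) {x} → x ∈ A → 0 < count A
count-pos A {zero} xA rewrite xA = s≤s z≤n
count-pos {suc n} A {suc x} xA = ≤-trans (count-pos (λ y → A (suc y)) xA) (m≤n+m _ (bit (A zero)))

count-empty : ∀ {n} {A : Vertices n} → (∀ x → x ∉ A) → count A ≡ 0
count-empty {zero}      none = refl
count-empty {suc n} {A} none rewrite none zero = count-empty (λ x → none (suc x))

count-split : ∀ {n} (A B : Vertices n) → count A ≡ count (A ∩ B) + count (A ∖ B)
count-split {zero}  A B = refl
count-split {suc n} A B = begin
  bit (A zero) + count A⁺
    ≡⟨ cong₂ _+_ (bit-split (A zero) (B zero)) (count-split A⁺ B⁺) ⟩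
  (bit ((A ∩ B) zero) + bit ((A ∖ B) zero)) + (count (A⁺ ∩ B⁺) + count (A⁺ ∖ B⁺))
    ≡⟨ interchange (bit ((A ∩ B) zero)) (bit ((A ∖ B) zero)) (count (A⁺ ∩ B⁺)) (count (A⁺ ∖ B⁺)) ⟩
  count (A ∩ B) + count (A ∖ B) ∎
  where
  open ≡-Reasoning
  A⁺ B⁺ : Vertices n
  A⁺ x = A (suc x)
  B⁺ x = B (suc x)
  bit-split : ∀ a b → bit a ≡ bit (a ∧ b) + bit (a ∧ not b)
  bit-split true  true  = refl
  bit-split true  false = refl
  bit-split false _     = refl

count-⊆ : ∀ {n} {S A : Vertices n} → S ⊆ A → count A ≡ count S + count (A ∖ S)
count-⊆ {S = S} {A} S⊆A =
  trans (count-split A S) (cong (_+ count (A ∖ S)) (count-ext (λ x → bool-≡ ∩-elimʳ (λ xS → ∩-intro (S⊆A x xS) xS))))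

count-⊂ : ∀ {n} (S A : Vertices n) {x} → S ⊆ A → x ∈ A → x ∉ S → count S < count A
count-⊂ S A S⊆A xA xS = subst (count S <_) (sym (count-⊆ S⊆A)) (m<m+n _ (count-pos (A ∖ S) (∖-intro xA xS)))

Relation : ℕ → Set
Relation n = Fin n → Fin n → Bool

Undirected : ∀ {n} → Relation n → Set
Undirected g = ∀ x y → g x y ≡ g y x

snoc : ∀ {n} {g : Relation n} {x y z} → Walk g x y → g y z ≡ true → Walk g x z
snoc []       e = e ∷ []
snoc (d ∷ w) e = d ∷ snoc w e

walk-map : ∀ {n} {g h : Relation n} (f : Fin n → Fin n) →
           (∀ x y → g x y ≡ true → h (f x) (f y) ≡ true) →
           ∀ {x y} → Walk g x y → Walk h (f x) (f y)
walk-map f edge []      = []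
walk-map f edge (e ∷ w) = edge _ _ e ∷ walk-map f edge w

Closed : ∀ {n} → Relation n → Vertices n → Set
Closed g A = ∀ x y → x ∈ A → g x y ≡ true → y ∈ A

walk-closed : ∀ {n} {g : Relation n} {A} → Closed g A → ∀ {x y} → Walk g x y → x ∈ A → y ∈ A
walk-closed cl []      xA = xA
walk-closed cl (e ∷ w) xA = walk-closed cl w (cl _ _ xA e)

record ComponentOf {n} (g : Relation n) (v : Fin n) : Set where
  field
    members  : Vertices n
    reached  : ∀ y → y ∈ members → Walk g v y
    complete : ∀ y → Walk g v y → y ∈ members
open ComponentOf

UniformComponents : ∀ {n} → Relation n → ℕ → Set
UniformComponents g k = ∀ v → Σ (ComponentOf g v) λ C → count (members C) ≡ k

module _ {n} {g : Relation n} where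

  component-⊆ : ∀ {A v} → Closed g A → v ∈ A → (C : ComponentOf g v) → members C ⊆ A
  component-⊆ cl vA C y yC = walk-closed cl (reached C y yC) vA

  minus-component-closed : ∀ {A v} → Undirected g → (C : ComponentOf g v) →
    (∀ x y → x ∈ A ∖ members C → g x y ≡ true → y ∈ A) → Closed g (A ∖ members C)
  minus-component-closed {A} gsym C stays x y x∈ e = ∖-intro (stays x y x∈ e) y∉C
    where
    y∉C : y ∉ members C
    y∉C = ¬∈⇒∉ λ yC → ∉⇒¬∈ (∖-elimʳ x∈) (complete C x (snoc (reached C y yC) (trans (gsym y x) e)))

  -- A closed set is a disjoint union of components, so its size is a
  -- multiple of the common component size.
  closed-divisible : ∀ {k A} → Undirected g → UniformComponents g k → Closed g A → k ∣ count A
  closed-divisible {k} gsym comps cl = peel _ _ ≤-refl cl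
    where
    peel : ∀ N A → count A ≤ N → Closed g A → k ∣ count A
    peel N A bound cl with inhabited? A
    peel N A bound cl | inj₂ none = subst (k ∣_) (sym (count-empty none)) (k ∣0)
    peel zero A bound cl | inj₁ (v , vA) = ⊥-elim (<⇒≱ (count-pos A vA) bound)
    peel (suc N) A bound cl | inj₁ (v , vA) =
      subst (k ∣_) (sym split) (∣m∣n⇒∣m+n ∣-refl (peel N rest smaller rest-closed))
      where
      C : ComponentOf g v
      C = proj₁ (comps v)
      rest : Vertices n
      rest = A ∖ members C
      split : count A ≡ k + count rest
      split = trans (count-⊆ (component-⊆ cl vA C)) (cong (_+ count rest) (proj₂ (comps v)))
      smaller : count rest ≤ N
      smaller = ≤-pred (≤-trans (+-monoˡ-≤ (count rest) k-pos) (subst (_≤ suc N) split bound))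
        where
        k-pos : 0 < k
        k-pos = subst (0 <_) (proj₂ (comps v)) (count-pos (members C) (complete C v []))
      rest-closed : Closed g rest
      rest-closed = minus-component-closed gsym C (λ x y x∈ → cl x y (∖-elimˡ x∈))

record Path {n} (g : Relation n) (x y : Fin n) : Set where
  field
    len   : ℕ
    at    : Fin (suc len) → Fin n
    inj   : Injective _≡_ _≡_ at
    start : at zero ≡ x
    end   : at (fromℕ len) ≡ y
    step  : ∀ t → g (at (inject₁ t)) (at (suc t)) ≡ true

-- Breadth-first search from u: the set of vertices reachable from u is
-- closed, and each reachable vertex is joined to u by a shortest path.

module BreadthFirst {n} (g : Relation n) (u : Fin n) where

  stage : ℕ → Vertices n
  stage zero    x = does (x ≟ u)
  stage (suc i) x = stage i x ∨ nonempty (stage i ∩ flip g x)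

  root : u ∈ stage zero
  root = dec-true (u ≟ u) refl

  stage-grows : ∀ i → stage i ⊆ stage (suc i)
  stage-grows i x xi rewrite xi = refl

  stage-mono : ∀ {i j} → i ≤ j → stage i ⊆ stage j
  stage-mono {j = zero} z≤n x xi = xi
  stage-mono {i} {suc j} i≤1+j x xi with m≤n⇒m<n∨m≡n i≤1+j
  ... | inj₁ (s≤s i≤j) = stage-grows j x (stage-mono i≤j x xi)
  ... | inj₂ refl      = xi

  stage-step : ∀ i {x y} → x ∈ stage i → g x y ≡ true → y ∈ stage (suc i)
  stage-step i {x} {y} xi e = ∨-introʳ (nonempty-intro (stage i ∩ flip g y) (∩-intro xi e))

  stage-back : ∀ i {x} → x ∈ stage (suc i) → x ∉ stage i → ∃ λ y → y ∈ stage i ∩ flip g x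
  stage-back i {x} x∈ x∉ = nonempty-elim (stage i ∩ flip g x) (∨-resolve x∈ x∉)

  settled : ∀ i → Closed g (stage i) → Closed g (stage (suc i))
  settled i cl x y x∈ e = stage-grows i y (cl x y x∈old e)
    where
    x∈old : x ∈ stage i
    x∈old = ¬∉⇒∈ λ x∉ → let (z , z∈) = stage-back i x∈ x∉ in ∉⇒¬∈ x∉ (cl z x (∩-elimˡ z∈) (∩-elimʳ z∈))

  closed-or-large : ∀ i → Closed g (stage i) ⊎ i < count (stage i)
  closed-or-large zero = inj₂ (count-pos (stage zero) {u} root)
  closed-or-large (suc i) with closed-or-large i
  ... | inj₁ cl = inj₁ (settled i cl)
  ... | inj₂ large with inhabited? (stage (suc i) ∖ stage i)
  ...   | inj₁ (x , new) = inj₂ (≤-trans (s≤s large) (count-⊂ (stage i) (stage (suc i)) (stage-grows i) (∖-elimˡ new) (∖-elimʳ new)))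
  ...   | inj₂ none      = inj₁ (settled i (λ x y x∈ e → old (stage-step i x∈ e)))
    where
    old : ∀ {y} → y ∈ stage (suc i) → y ∈ stage i
    old {y} y∈ = ¬∉⇒∈ λ y∉ → ∉⇒¬∈ (none y) (∖-intro y∈ y∉)

  -- The reachable set: there are only n vertices, so stage n is closed.
  reach : Vertices n
  reach = stage n

  reach-root : u ∈ reach
  reach-root = stage-mono {j = n} z≤n u root

  reach-closed : Closed g reach
  reach-closed with closed-or-large n
  ... | inj₁ cl    = cl
  ... | inj₂ large = ⊥-elim (<⇒≱ large (count-≤ reach))

  AtDistance : ℕ → Fin n → Set
  AtDistance zero    x = x ∈ stage zero
  AtDistance (suc d) x = x ∈ stage (suc d) × x ∉ stage d

  at-stage : ∀ {d x} → AtDistance d x → x ∈ stage d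
  at-stage {zero}  xd = xd
  at-stage {suc d} xd = proj₁ xd

  distance-of : ∀ i {x} → x ∈ stage i → ∃ λ d → AtDistance d x
  distance-of zero    xi = zero , xi
  distance-of (suc i) {x} xi with stage i x Bool.≟ true
  ... | yes earlier = distance-of i earlier
  ... | no  fresh   = suc i , xi , ¬∈⇒∉ fresh

  not-before : ∀ {d x i} → AtDistance d x → i < d → x ∉ stage i
  not-before {suc d} (_ , x∉) (s≤s i≤d) = ¬∈⇒∉ λ xi → ∉⇒¬∈ x∉ (stage-mono i≤d _ xi)

  distance-unique : ∀ {i j x} → AtDistance i x → AtDistance j x → i ≡ j
  distance-unique {i} {j} xi xj with <-cmp i j
  ... | tri< i<j _ _ = ⊥-elim (∉⇒¬∈ (not-before xj i<j) (at-stage xi))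
  ... | tri≈ _ i≡j _ = i≡j
  ... | tri> _ _ j<i = ⊥-elim (∉⇒¬∈ (not-before xi j<i) (at-stage xj))

  predecessor : ∀ {d x} → AtDistance (suc d) x → ∃ λ y → AtDistance d y × g y x ≡ true
  predecessor {d} (x∈ , x∉) =
    let (y , y∈) = stage-back d x∈ x∉ in y , exact d (∩-elimˡ y∈) (∩-elimʳ y∈) x∉ , ∩-elimʳ y∈
    where
    exact : ∀ d {x y} → y ∈ stage d → g y x ≡ true → x ∉ stage d → AtDistance d y
    exact zero     y∈ _ _  = y∈
    exact (suc d′) y∈ e x∉ = y∈ , ¬∈⇒∉ λ y∈′ → ∉⇒¬∈ x∉ (stage-step d′ y∈′ e)

  back : ∀ d x → AtDistance d x → Fin (suc d) → Fin n
  back d       x xd zero    = x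
  back (suc d) x xd (suc t) = let (y , yd , _) = predecessor {d} xd in back d y yd t

  back-distance : ∀ d x xd t → AtDistance (d ∸ toℕ t) (back d x xd t)
  back-distance d       x xd zero    = xd
  back-distance (suc d) x xd (suc t) = let (y , yd , _) = predecessor {d} xd in back-distance d y yd t

  back-step : ∀ d x xd t → g (back d x xd (suc t)) (back d x xd (inject₁ t)) ≡ true
  back-step (suc d) x xd zero    = proj₂ (proj₂ (predecessor {d} xd))
  back-step (suc d) x xd (suc t) = let (y , yd , _) = predecessor {d} xd in back-step d y yd t

  back-end : ∀ d x xd → back d x xd (fromℕ d) ≡ u
  back-end zero    x xd = witness (x ≟ u) xd
  back-end (suc d) x xd = let (y , yd , _) = predecessor {d} xd in back-end d y yd

  -- Distinct positions have distinct distances, hence distinct vertices.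
  back-inj : ∀ d x xd → Injective _≡_ _≡_ (back d x xd)
  back-inj d x xd {s} {t} eq = toℕ-injective (∸-cancelˡ-≡ (toℕ≤pred[n] s) (toℕ≤pred[n] t)
    (distance-unique (subst (AtDistance (d ∸ toℕ s)) eq (back-distance d x xd s)) (back-distance d x xd t)))

  shortest-path : ∀ {x} → x ∈ reach → Path (flip g) x u
  shortest-path xr = let (d , xd) = distance-of n xr in record
    { len = d ; at = back d _ xd ; inj = back-inj d _ xd ; start = refl
    ; end = back-end d _ xd ; step = back-step d _ xd }

record SideOf {n} (T : Graph n) (u v : Fin n) : Set where
  field
    side     : Vertices n
    u∈side   : u ∈ side
    v∉side   : v ∉ side
    closed   : ∀ {x y} → x ∈ side → adj T x y ≡ true → ¬ (x ≡ u × y ≡ v) → y ∈ side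

edge-cut : ∀ {n} (T : Graph n) → Acyclic T → ∀ {u v} → adj T u v ≡ true → SideOf T u v
edge-cut {n} T acyclic {u} {v} uv = record { side = reach ; u∈side = reach-root ; v∉side = v∉ ; closed = closure }
  where
  IsUV : Fin n → Fin n → Set
  IsUV x y = (x ≡ u × y ≡ v) ⊎ (x ≡ v × y ≡ u)

  isUV? : ∀ x y → Dec (IsUV x y)
  isUV? x y = (x ≟ u ×-dec y ≟ v) ⊎-dec (x ≟ v ×-dec y ≟ u)

  cut : Relation n
  cut x y = adj T x y ∧ not (does (isUV? x y))

  cut-keeps : ∀ {x y} → adj T x y ≡ true → ¬ IsUV x y → cut x y ≡ true
  cut-keeps {x} {y} e ¬uv rewrite e | dec-false (isUV? x y) ¬uv = refl

  uv-cut : cut u v ≡ false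
  uv-cut rewrite dec-true (isUV? u v) (inj₁ (refl , refl)) = ∧-zeroʳ (adj T u v)

  open BreadthFirst cut u

  -- A path v … u avoiding uv has length ≥ 2 and closes a cycle with uv.
  no-path : Path (flip cut) v u → ⊥
  no-path record { len = zero ; start = s ; end = e } =
    ∉⇒¬∈ (Graph.irrefl T u) (subst (λ w → adj T u w ≡ true) (trans (sym s) e) uv)
  no-path record { len = suc zero ; start = s ; end = e ; step = st } =
    ∉⇒¬∈ uv-cut (subst₂ (λ a b → cut a b ≡ true) e s (st zero))
  no-path record { len = suc (suc m) ; at = at ; inj = inj ; start = s ; end = e ; step = st } = acyclic record
    { m = m ; c = at ; inj = inj
    ; step = λ i → trans (Graph.sym T _ _) (∧-conicalˡ _ _ (st i))
    ; close = subst₂ (λ a b → adj T a b ≡ true) (sym e) (sym s) uv }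

  v∉ : v ∉ reach
  v∉ = ¬∈⇒∉ λ vr → no-path (shortest-path vr)

  closure : ∀ {x y} → x ∈ reach → adj T x y ≡ true → ¬ (x ≡ u × y ≡ v) → y ∈ reach
  closure {x} {y} xr e not-uv with isUV? x y
  ... | yes (inj₁ xy)         = ⊥-elim (not-uv xy)
  ... | yes (inj₂ (refl , _)) = ⊥-elim (∉⇒¬∈ v∉ xr)
  ... | no ¬uv                = reach-closed x y xr (cut-keeps e ¬uv)

record BalancedSplit {n} (T : Graph n) (k : ℕ) : Set where
  field
    edge       : Relation n
    undirected : Undirected edge
    inside     : ∀ x y → edge x y ≡ true → adj T x y ≡ true
    components : UniformComponents edge k
open BalancedSplit

shared-edge : ∀ {n k} (T : Graph n) → Acyclic T → (G H : BalancedSplit T k) →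
              ∀ {u v} → edge G u v ≡ true → edge H u v ≡ true
shared-edge {n} {k} T acyclic G H {u} {v} guv = ¬∉⇒∈ λ huv → <⇒≱ overlap-small (overlap-large huv)
  where
  open SideOf (edge-cut T acyclic (inside G u v guv)) renaming (side to A; u∈side to uA; v∉side to vA; closed to A-closed)
  C : ComponentOf (edge G) u
  C = proj₁ (components G u)
  uC : u ∈ members C
  uC = complete C u []
  vC : v ∈ members C
  vC = complete C v (guv ∷ [])

  -- A ∩ C is a nonempty proper part of C, which has k vertices ...
  overlap-small : count (A ∩ members C) < k
  overlap-small = subst (count (A ∩ members C) <_) (proj₂ (components G u))
    (count-⊂ (A ∩ members C) (members C) (λ _ → ∩-elimʳ) vC (¬∈⇒∉ λ v∈ → ∉⇒¬∈ vA (∩-elimˡ v∈)))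

  -- ... yet k divides |A| (no H-edge leaves A) and |A ∖ C| (no G-edge leaves it).
  overlap-large : v ∉ edge H u → k ≤ count (A ∩ members C)
  overlap-large huv = ∣⇒≤ {{>-nonZero (count-pos (A ∩ members C) (∩-intro uA uC))}}
    (∣m+n∣m⇒∣n (subst (k ∣_) (trans (count-split A (members C)) (+-comm (count (A ∩ members C)) _)) k∣A) k∣A∖C)
    where
    k∣A : k ∣ count A
    k∣A = closed-divisible (undirected H) (components H)
      (λ x y xA e → A-closed xA (inside H x y e) λ { (refl , refl) → ∉⇒¬∈ huv e })
    k∣A∖C : k ∣ count (A ∖ members C)
    k∣A∖C = closed-divisible (undirected G) (components G) (minus-component-closed (undirected G) C
      (λ x y x∈ e → A-closed (∖-elimˡ x∈) (inside G x y e) λ { (refl , refl) → ∉⇒¬∈ (∖-elimʳ x∈) uC }))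

components-transfer : ∀ {n k} {g h : Relation n} (π : Fin n ↔ Fin n) →
  (∀ x y → g x y ≡ h (Inverse.to π x) (Inverse.to π y)) →
  UniformComponents h k → UniformComponents g k
components-transfer {n} {g = g} {h} π maps comps x = component , trans (count-↔ relabel) (proj₂ (comps (to x)))
  where
  open Inverse π using (to; from; strictlyInverseˡ; strictlyInverseʳ)
  C : ComponentOf h (to x)
  C = proj₁ (comps (to x))
  S : Vertices n
  S y = members C (to y)
  back-edge : ∀ a b → h a b ≡ true → g (from a) (from b) ≡ true
  back-edge a b e = trans (maps (from a) (from b)) (trans (cong₂ h (strictlyInverseˡ a) (strictlyInverseˡ b)) e)
  component : ComponentOf g x
  component = record
    { members  = S
    ; reached  = λ y y∈ → subst₂ (Walk g) (strictlyInverseʳ x) (strictlyInverseʳ y)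
                            (walk-map from back-edge (reached C (to y) y∈))
    ; complete = λ y w → complete C (to y) (walk-map to (λ a b e → trans (sym (maps a b)) e) w) }
  relabel : Members S ↔ Members (members C)
  relabel = mk↔ₛ′ (λ { (y , p) → to y , p })
                  (λ { (z , q) → from z , subst (_∈ members C) (sym (strictlyInverseˡ z)) q })
                  (λ { (z , q) → member-≡ (strictlyInverseˡ z) })
                  (λ { (y , p) → member-≡ (strictlyInverseʳ y) })

full-transfer : ∀ {n} {A B : Vertices n} → (∀ x → x ∈ B) → Members A ↔ Members B → ∀ x → x ∈ A
full-transfer {A = A} {B} full f x = ¬∉⇒∈ λ x∉ →
  <⇒≱ (count-⊂ A B (λ y _ → full y) (full x) x∉) (≤-reflexive (sym (count-↔ f)))

full↔ : ∀ {n} {A : Vertices n} → (∀ x → x ∈ A) → Members A ↔ Fin n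
full↔ full = mk↔ₛ′ proj₁ (λ x → x , full x) (λ _ → refl) (λ _ → member-≡ refl)

uniform-components : ∀ {n k} {T : Graph n} (F : Subgraph T) → Spanning F →
                     AllComponentsOfSize F k → UniformComponents (sadj F) k
uniform-components F spanning sizes v =
  let (S , S-comp , size) = sizes v (spanning v) in
  record { members  = S
         ; reached  = λ y y∈ → proj₂ (proj₂ (proj₁ (S-comp y) y∈))
         ; complete = λ y w → proj₂ (S-comp y) (spanning v , spanning y , w) }
  , sym (↔⇒≡ (↔-trans size (members↔ S)))

balanced : ∀ {n k} {T : Graph n} (F : Subgraph T) → UniformComponents (sadj F) k → BalancedSplit T k
balanced F comps = record { edge = sadj F ; undirected = ssym F ; inside = sub F ; components = comps }

-- Any copy F' is spanning,
-- the isomorphism is a permutation of V(T) carrying F's components onto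
-- those of F', and two balanced splits of a tree have the same edges.
lemma5p9 : ∀ {n : ℕ} (T : Graph n) → IsTree T → (F : Subgraph T) → Spanning F → (∃ λ k → AllComponentsOfSize F k) → UniqueCopy F
lemma5p9 {n} T (_ , acyclic) F spanning (k , sizes) = (↔-refl , λ _ _ → refl) , unique
  where
  G : BalancedSplit T k
  G = balanced F (uniform-components F spanning sizes)
  unique : ∀ F' → F' ≅ F → F' ≈S F
  unique F' (f , preserves) = (λ v → trans (spanning' v) (sym (spanning v))) , edges
    where
    spanning' : Spanning F'
    spanning' = full-transfer spanning f
    π : Fin n ↔ Fin n
    π = ↔-trans (↔-sym (full↔ spanning')) (↔-trans f (full↔ spanning))
    G' : BalancedSplit T k
    G' = balanced F' (components-transfer π (λ x y → preserves (x , spanning' x) (y , spanning' y))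
                                              (components G))
    edges : ∀ a b → sadj F' a b ≡ sadj F a b
    edges a b = bool-≡ (shared-edge T acyclic G' G) (shared-edge T acyclic G G')
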